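{- If $\mathbb{A}=(L,\wedge,\vee,{}',\top,\bot)$ is a demi pseudocomplemented lattice, then its kernel $\mathbb{K}_{\mathbb{A}}=(K,\cap,\cup,{}^*,1,0)$ is a Boolean algebra.
   Context: A semi De Morgan algebra (SMA) is an algebra $(L,\wedge,\vee,{}',\top,\bot)$ such that $(L,\wedge,\vee,\top,\bot)$ is a bounded distributive lattice and for all $a,b\in L$: $\bot'=\top$, $\top'=\bot$, $(a\vee b)'=a'\wedge b'$, $(a\wedge b)''=a''\wedge b''$, $a'=a'''$. A demi pseudocomplemented lattice (DPL) is an SMA satisfying $a'\wedge a''=\bot$ for all $a$. For an SMA, let $K=\{a'':a\in L\}$, $h:L\to K$ given by $h(a)=a''$, and $e:K\to L$ the inclusion. The kernel $\mathbb{K}_{\mathbb{A}}=(K,\cap,\cup,{}^*,1,0)$ is defined by $\alpha\cup\beta=h((e(\alpha)\vee e(\beta))'')$, $\alpha\cap\beta=h(e(\alpha)\wedge e(\beta))$, $1=h(\top)$, $0=h(\bot)$, $\alpha^*=h(e(\alpha)')$. A Boolean algebra here is a De Morgan algebra (bounded distributive lattice with $0^*=1$, $1^*=0$, $(a\cup b)^*=a^*\cap b^*$, $(a\cap b)^*=a^*\cup b^*$, $a^{**}=a$) satisfying $a\cap a^*=0$ for all $a$. -}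

module Defs where

open import Level using (Level; _⊔_)
open import Algebra.Core using (Op₁; Op₂)
open import Data.Product using (Σ; ∃; _,_; proj₁; _×_)
open import Relation.Binary.Core using (Rel)
open import Relation.Binary.PropositionalEquality using (_≡_; refl)
import Algebra.Definitions
import Algebra.Lattice.Structures

module _ {a ℓ : Level} {A : Set a} (_≈_ : Rel A ℓ) where
  open Algebra.Definitions _≈_
  open Algebra.Lattice.Structures _≈_

  record IsBoundedDistributiveLattice (_∧_ _∨_ : Op₂ A) (⊤ ⊥ : A) : Set (a ⊔ ℓ) where
    field
      isDistributiveLattice : IsDistributiveLattice _∨_ _∧_
      ∧-identity-⊤ : Identity ⊤ _∧_
      ∨-identity-⊥ : Identity ⊥ _∨_

  record IsDeMorganAlgebra (_∩_ _∪_ : Op₂ A) (_* : Op₁ A) (𝟙 𝟘 : A) : Set (a ⊔ ℓ) where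
    field
      isBDL   : IsBoundedDistributiveLattice _∩_ _∪_ 𝟙 𝟘
      *-cong  : Congruent₁ _*
      𝟘*≈𝟙    : (𝟘 *) ≈ 𝟙
      𝟙*≈𝟘    : (𝟙 *) ≈ 𝟘
      ∪-*     : ∀ x y → ((x ∪ y) *) ≈ ((x *) ∩ (y *))
      ∩-*     : ∀ x y → ((x ∩ y) *) ≈ ((x *) ∪ (y *))
      **-inv  : ∀ x → ((x *) *) ≈ x

  record IsBooleanAlg (_∩_ _∪_ : Op₂ A) (_* : Op₁ A) (𝟙 𝟘 : A) : Set (a ⊔ ℓ) where
    field
      isDeMorganAlgebra : IsDeMorganAlgebra _∩_ _∪_ _* 𝟙 𝟘
      ∩-complement      : ∀ x → (x ∩ (x *)) ≈ 𝟘

module _ {a : Level} {L : Set a} where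

  record IsSMA (_∧_ _∨_ : Op₂ L) (_′ : Op₁ L) (⊤ ⊥ : L) : Set a where
    field
      isBDL  : IsBoundedDistributiveLattice _≡_ _∧_ _∨_ ⊤ ⊥
      ⊥′≡⊤   : (⊥ ′) ≡ ⊤
      ⊤′≡⊥   : (⊤ ′) ≡ ⊥
      ∨-′    : ∀ x y → ((x ∨ y) ′) ≡ ((x ′) ∧ (y ′))
      ∧-′′   : ∀ x y → (((x ∧ y) ′) ′) ≡ (((x ′) ′) ∧ ((y ′) ′))
      ′′′    : ∀ x → (x ′) ≡ (((x ′) ′) ′)

  record IsDPL (_∧_ _∨_ : Op₂ L) (_′ : Op₁ L) (⊤ ⊥ : L) : Set a where
    field
      isSMA : IsSMA _∧_ _∨_ _′ ⊤ ⊥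
      dpl   : ∀ x → ((x ′) ∧ ((x ′) ′)) ≡ ⊥

-- The kernel K = { a'' : a ∈ L } with its operations.
-- Elements of K are pairs (x , a , x ≡ a''); two elements are equal
-- when their underlying elements of L are equal.

module Kernel {a : Level} {L : Set a}
              (_∧_ _∨_ : Op₂ L) (_′ : Op₁ L) (⊤ ⊥ : L) where

  K : Set a
  K = Σ L (λ x → ∃ λ y → x ≡ ((y ′) ′))

  _≈K_ : Rel K a
  α ≈K β = proj₁ α ≡ proj₁ β

  h : L → K
  h y = ((y ′) ′) , y , refl

  e : K → L
  e = proj₁

  _∪_ : Op₂ K
  α ∪ β = h (((e α ∨ e β) ′) ′)

  _∩_ : Op₂ K
  α ∩ β = h (e α ∧ e β)

  𝟙 : K
  𝟙 = h ⊤

  𝟘 : K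
  𝟘 = h ⊥

  _* : Op₁ K
  α * = h (e α ′)

module Submission where

-- Write ν x = x''.  In a semi De Morgan algebra x''' = x', so ν is
-- idempotent and the kernel K = ν[L] is exactly its set of fixed points.
-- The whole proof rests on describing the kernel operations through the
-- inclusion e : K → L:
--   e (α ∩ β) = e α ∧ e β,   e (α ∪ β) = ν (e α ∨ e β),   e (α *) = (e α)',
-- together with two facts about ν: it preserves meets (an axiom) and it
-- absorbs ν inside a join, ν (ν x ∨ y) = ν (x ∨ y).  With these, every
-- law of a De Morgan algebra for K is a law of the lattice L pushed
-- through ν; so the kernel of every semi De Morgan algebra is a De Morgan
-- algebra (module SMAKernel).  For a demi pseudocomplemented lattice the
-- extra law a' ∧ a'' = ⊥ gives α ∩ α* = 0 (module DPLKernel), which is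
-- the Boolean law of Corollary 3.4.

open import Defs
open import Level using (Level)
open import Algebra.Core using (Op₁; Op₂)
open import Data.Product using (_,_; proj₁)
open import Relation.Binary.Bundles using (Setoid)
open import Relation.Binary.PropositionalEquality
import Relation.Binary.Construct.On as On
import Algebra.Consequences.Setoid as Consequences
import Algebra.Definitions as AlgebraDefinitions
import Algebra.Lattice.Structures as LatticeStructures

module SMAKernel {a : Level} {L : Set a} (meet join : Op₂ L) (neg : Op₁ L) (⊤ ⊥ : L)
                 (sma : IsSMA meet join neg ⊤ ⊥) where

  _∧_ = meet
  _∨_ = join
  _′ = neg
  infixl 9 _′
  infixr 7 _∧_
  infixr 6 _∨_

  open Kernel _∧_ _∨_ _′ ⊤ ⊥
  open IsSMA sma
  open IsBoundedDistributiveLattice isBDL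
  open LatticeStructures.IsDistributiveLattice isDistributiveLattice
    using (∧-comm; ∨-comm; ∧-assoc; ∨-assoc; ∧-absorbs-∨; ∨-absorbs-∧;
           ∧-distribˡ-∨; ∨-distribˡ-∧)
  open ≡-Reasoning

  ′′′-collapse : ∀ x → x ′ ′ ′ ≡ x ′
  ′′′-collapse x = sym (′′′ x)

  ′′-idempotent : ∀ x → x ′ ′ ′ ′ ≡ x ′ ′
  ′′-idempotent x = cong _′ (′′′-collapse x)

  e-fixed : ∀ α → e α ′ ′ ≡ e α
  e-fixed (_ , y , refl) = ′′-idempotent y

  -- Negation does not see a double negation inside a join; this is what
  -- lets the kernel join ν (e α ∨ e β) be computed in L.
  ′-absorbs-′′ˡ : ∀ x y → (x ′ ′ ∨ y) ′ ≡ (x ∨ y) ′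
  ′-absorbs-′′ˡ x y = begin
    (x ′ ′ ∨ y) ′    ≡⟨ ∨-′ _ _ ⟩
    x ′ ′ ′ ∧ y ′    ≡⟨ cong (_∧ y ′) (′′′-collapse x) ⟩
    x ′ ∧ y ′        ≡⟨ ∨-′ x y ⟨
    (x ∨ y) ′        ∎

  ′-absorbs-′′ʳ : ∀ x y → (x ∨ y ′ ′) ′ ≡ (x ∨ y) ′
  ′-absorbs-′′ʳ x y = begin
    (x ∨ y ′ ′) ′    ≡⟨ cong _′ (∨-comm x _) ⟩
    (y ′ ′ ∨ x) ′    ≡⟨ ′-absorbs-′′ˡ y x ⟩
    (y ∨ x) ′        ≡⟨ cong _′ (∨-comm y x) ⟩
    (x ∨ y) ′        ∎

  e-∩ : ∀ α β → e (α ∩ β) ≡ e α ∧ e β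
  e-∩ α β = trans (∧-′′ (e α) (e β)) (cong₂ _∧_ (e-fixed α) (e-fixed β))

  e-∪ : ∀ α β → e (α ∪ β) ≡ (e α ∨ e β) ′ ′
  e-∪ α β = ′′-idempotent (e α ∨ e β)

  e-* : ∀ α → e (α *) ≡ e α ′
  e-* α = ′′′-collapse (e α)

  e-𝟙 : e 𝟙 ≡ ⊤
  e-𝟙 = trans (cong _′ ⊤′≡⊥) ⊥′≡⊤

  e-𝟘 : e 𝟘 ≡ ⊥
  e-𝟘 = trans (cong _′ ⊥′≡⊤) ⊤′≡⊥

  K-setoid : Setoid a a
  K-setoid = On.setoid (setoid L) e

  open Consequences K-setoid using (comm∧idˡ⇒id; comm∧distrˡ⇒distr)
  open AlgebraDefinitions _≈K_ using (Congruent₂)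

  ∪-comm : ∀ α β → (α ∪ β) ≈K (β ∪ α)
  ∪-comm α β = cong (λ z → z ′ ′ ′ ′) (∨-comm (e α) (e β))

  ∩-comm : ∀ α β → (α ∩ β) ≈K (β ∩ α)
  ∩-comm α β = cong (λ z → z ′ ′) (∧-comm (e α) (e β))

  -- Kernel equality only compares images under e, so Agda cannot infer
  -- the implicit arguments of these congruences; uses below pass them.
  ∪-cong : Congruent₂ _∪_
  ∪-cong = cong₂ (λ x y → (x ∨ y) ′ ′ ′ ′)

  ∩-cong : Congruent₂ _∩_
  ∩-cong = cong₂ (λ x y → (x ∧ y) ′ ′)

  ∪-assoc : ∀ α β γ → ((α ∪ β) ∪ γ) ≈K (α ∪ (β ∪ γ))
  ∪-assoc α β γ = begin
    e ((α ∪ β) ∪ γ)              ≡⟨ e-∪ (α ∪ β) γ ⟩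
    (e (α ∪ β) ∨ e γ) ′ ′        ≡⟨ cong (λ z → (z ∨ e γ) ′ ′) (e-∪ α β) ⟩
    ((e α ∨ e β) ′ ′ ∨ e γ) ′ ′  ≡⟨ cong _′ (′-absorbs-′′ˡ _ _) ⟩
    ((e α ∨ e β) ∨ e γ) ′ ′      ≡⟨ cong (λ z → z ′ ′) (∨-assoc _ _ _) ⟩
    (e α ∨ (e β ∨ e γ)) ′ ′      ≡⟨ cong _′ (′-absorbs-′′ʳ _ _) ⟨
    (e α ∨ (e β ∨ e γ) ′ ′) ′ ′  ≡⟨ cong (λ z → (e α ∨ z) ′ ′) (e-∪ β γ) ⟨
    (e α ∨ e (β ∪ γ)) ′ ′        ≡⟨ e-∪ α (β ∪ γ) ⟨
    e (α ∪ (β ∪ γ))              ∎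

  ∩-assoc : ∀ α β γ → ((α ∩ β) ∩ γ) ≈K (α ∩ (β ∩ γ))
  ∩-assoc α β γ = begin
    e ((α ∩ β) ∩ γ)        ≡⟨ e-∩ (α ∩ β) γ ⟩
    e (α ∩ β) ∧ e γ        ≡⟨ cong (_∧ e γ) (e-∩ α β) ⟩
    (e α ∧ e β) ∧ e γ      ≡⟨ ∧-assoc _ _ _ ⟩
    e α ∧ (e β ∧ e γ)      ≡⟨ cong (e α ∧_) (e-∩ β γ) ⟨
    e α ∧ e (β ∩ γ)        ≡⟨ e-∩ α (β ∩ γ) ⟨
    e (α ∩ (β ∩ γ))        ∎

  ∪-absorbs-∩ : ∀ α β → (α ∪ (α ∩ β)) ≈K α
  ∪-absorbs-∩ α β = begin
    e (α ∪ (α ∩ β))              ≡⟨ e-∪ α (α ∩ β) ⟩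
    (e α ∨ e (α ∩ β)) ′ ′        ≡⟨ cong (λ z → (e α ∨ z) ′ ′) (e-∩ α β) ⟩
    (e α ∨ e α ∧ e β) ′ ′        ≡⟨ cong (λ z → z ′ ′) (∨-absorbs-∧ _ _) ⟩
    e α ′ ′                      ≡⟨ e-fixed α ⟩
    e α                          ∎

  -- ν is monotone: its meet with ν (x ∨ y) leaves ν x unchanged.
  ∩-absorbs-∪ : ∀ α β → (α ∩ (α ∪ β)) ≈K α
  ∩-absorbs-∪ α β = begin
    e (α ∩ (α ∪ β))              ≡⟨ e-∩ α (α ∪ β) ⟩
    e α ∧ e (α ∪ β)              ≡⟨ cong (e α ∧_) (e-∪ α β) ⟩
    e α ∧ (e α ∨ e β) ′ ′        ≡⟨ cong (_∧ (e α ∨ e β) ′ ′) (e-fixed α) ⟨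
    e α ′ ′ ∧ (e α ∨ e β) ′ ′    ≡⟨ ∧-′′ _ _ ⟨
    (e α ∧ (e α ∨ e β)) ′ ′      ≡⟨ cong (λ z → z ′ ′) (∧-absorbs-∨ _ _) ⟩
    e α ′ ′                      ≡⟨ e-fixed α ⟩
    e α                          ∎

  ∪-distribˡ-∩ : ∀ α β γ → (α ∪ (β ∩ γ)) ≈K ((α ∪ β) ∩ (α ∪ γ))
  ∪-distribˡ-∩ α β γ = begin
    e (α ∪ (β ∩ γ))                          ≡⟨ e-∪ α (β ∩ γ) ⟩
    (e α ∨ e (β ∩ γ)) ′ ′                    ≡⟨ cong (λ z → (e α ∨ z) ′ ′) (e-∩ β γ) ⟩
    (e α ∨ e β ∧ e γ) ′ ′                    ≡⟨ cong (λ z → z ′ ′) (∨-distribˡ-∧ _ _ _) ⟩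
    ((e α ∨ e β) ∧ (e α ∨ e γ)) ′ ′          ≡⟨ ∧-′′ _ _ ⟩
    (e α ∨ e β) ′ ′ ∧ (e α ∨ e γ) ′ ′        ≡⟨ cong₂ _∧_ (e-∪ α β) (e-∪ α γ) ⟨
    e (α ∪ β) ∧ e (α ∪ γ)                    ≡⟨ e-∩ (α ∪ β) (α ∪ γ) ⟨
    e ((α ∪ β) ∩ (α ∪ γ))                    ∎

  ∩-distribˡ-∪ : ∀ α β γ → (α ∩ (β ∪ γ)) ≈K ((α ∩ β) ∪ (α ∩ γ))
  ∩-distribˡ-∪ α β γ = begin
    e (α ∩ (β ∪ γ))                          ≡⟨ e-∩ α (β ∪ γ) ⟩
    e α ∧ e (β ∪ γ)                          ≡⟨ cong (e α ∧_) (e-∪ β γ) ⟩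
    e α ∧ (e β ∨ e γ) ′ ′                    ≡⟨ cong (_∧ (e β ∨ e γ) ′ ′) (e-fixed α) ⟨
    e α ′ ′ ∧ (e β ∨ e γ) ′ ′                ≡⟨ ∧-′′ _ _ ⟨
    (e α ∧ (e β ∨ e γ)) ′ ′                  ≡⟨ cong (λ z → z ′ ′) (∧-distribˡ-∨ _ _ _) ⟩
    (e α ∧ e β ∨ e α ∧ e γ) ′ ′              ≡⟨ cong (λ z → (z ∨ e α ∧ e γ) ′ ′) (e-∩ α β) ⟨
    (e (α ∩ β) ∨ e α ∧ e γ) ′ ′              ≡⟨ cong (λ z → (e (α ∩ β) ∨ z) ′ ′) (e-∩ α γ) ⟨
    (e (α ∩ β) ∨ e (α ∩ γ)) ′ ′              ≡⟨ e-∪ (α ∩ β) (α ∩ γ) ⟨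
    e ((α ∩ β) ∪ (α ∩ γ))                    ∎

  ∩-identityˡ : ∀ α → (𝟙 ∩ α) ≈K α
  ∩-identityˡ α = begin
    e (𝟙 ∩ α)        ≡⟨ e-∩ 𝟙 α ⟩
    e 𝟙 ∧ e α        ≡⟨ cong (_∧ e α) e-𝟙 ⟩
    ⊤ ∧ e α          ≡⟨ proj₁ ∧-identity-⊤ (e α) ⟩
    e α              ∎

  ∪-identityˡ : ∀ α → (𝟘 ∪ α) ≈K α
  ∪-identityˡ α = begin
    e (𝟘 ∪ α)        ≡⟨ e-∪ 𝟘 α ⟩
    (e 𝟘 ∨ e α) ′ ′  ≡⟨ cong (λ z → (z ∨ e α) ′ ′) e-𝟘 ⟩
    (⊥ ∨ e α) ′ ′    ≡⟨ cong (λ z → z ′ ′) (proj₁ ∨-identity-⊥ (e α)) ⟩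
    e α ′ ′          ≡⟨ e-fixed α ⟩
    e α              ∎

  kernel-isBDL : IsBoundedDistributiveLattice _≈K_ _∩_ _∪_ 𝟙 𝟘
  kernel-isBDL = record
    { isDistributiveLattice = record
      { isLattice = record
        { isEquivalence = Setoid.isEquivalence K-setoid
        ; ∨-comm        = ∪-comm
        ; ∨-assoc       = ∪-assoc
        ; ∨-cong        = λ {α α′ β β′} → ∪-cong {α} {α′} {β} {β′}
        ; ∧-comm        = ∩-comm
        ; ∧-assoc       = ∩-assoc
        ; ∧-cong        = λ {α α′ β β′} → ∩-cong {α} {α′} {β} {β′}
        ; absorptive    = ∪-absorbs-∩ , ∩-absorbs-∪
        }
      ; ∨-distrib-∧ = comm∧distrˡ⇒distr {_∪_} {_∩_}
                        (λ {α α′ β β′} → ∩-cong {α} {α′} {β} {β′}) ∪-comm ∪-distribˡ-∩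
      ; ∧-distrib-∨ = comm∧distrˡ⇒distr {_∩_} {_∪_}
                        (λ {α α′ β β′} → ∪-cong {α} {α′} {β} {β′}) ∩-comm ∩-distribˡ-∪
      }
    ; ∧-identity-⊤ = comm∧idˡ⇒id {_∩_} ∩-comm {𝟙} ∩-identityˡ
    ; ∨-identity-⊥ = comm∧idˡ⇒id {_∪_} ∪-comm {𝟘} ∪-identityˡ
    }

  ∪-* : ∀ α β → ((α ∪ β) *) ≈K ((α *) ∩ (β *))
  ∪-* α β = begin
    e ((α ∪ β) *)            ≡⟨ e-* (α ∪ β) ⟩
    e (α ∪ β) ′              ≡⟨ cong _′ (e-∪ α β) ⟩
    (e α ∨ e β) ′ ′ ′        ≡⟨ ′′′-collapse _ ⟩
    (e α ∨ e β) ′            ≡⟨ ∨-′ _ _ ⟩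
    e α ′ ∧ e β ′            ≡⟨ cong₂ _∧_ (e-* α) (e-* β) ⟨
    e (α *) ∧ e (β *)        ≡⟨ e-∩ (α *) (β *) ⟨
    e ((α *) ∩ (β *))        ∎

  ∩-* : ∀ α β → ((α ∩ β) *) ≈K ((α *) ∪ (β *))
  ∩-* α β = begin
    e ((α ∩ β) *)            ≡⟨ e-* (α ∩ β) ⟩
    e (α ∩ β) ′              ≡⟨ cong _′ (e-∩ α β) ⟩
    (e α ∧ e β) ′            ≡⟨ cong _′ (cong₂ _∧_ (e-fixed α) (e-fixed β)) ⟨
    (e α ′ ′ ∧ e β ′ ′) ′    ≡⟨ cong _′ (∨-′ _ _) ⟨
    (e α ′ ∨ e β ′) ′ ′      ≡⟨ cong (λ z → z ′ ′) (cong₂ _∨_ (e-* α) (e-* β)) ⟨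
    (e (α *) ∨ e (β *)) ′ ′  ≡⟨ e-∪ (α *) (β *) ⟨
    e ((α *) ∪ (β *))        ∎

  kernel-isDeMorgan : IsDeMorganAlgebra _≈K_ _∩_ _∪_ _* 𝟙 𝟘
  kernel-isDeMorgan = record
    { isBDL  = kernel-isBDL
    ; *-cong = cong (λ z → z ′ ′ ′)
    ; 𝟘*≈𝟙   = trans (e-* 𝟘) (trans (cong _′ e-𝟘) (trans ⊥′≡⊤ (sym e-𝟙)))
    ; 𝟙*≈𝟘   = trans (e-* 𝟙) (trans (cong _′ e-𝟙) (trans ⊤′≡⊥ (sym e-𝟘)))
    ; ∪-*    = ∪-*
    ; ∩-*    = ∩-*
    ; **-inv = λ α → trans (e-* (α *)) (trans (cong _′ (e-* α)) (e-fixed α))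
    }

module DPLKernel {a : Level} {L : Set a} (meet join : Op₂ L) (neg : Op₁ L) (⊤ ⊥ : L)
                 (isDPL : IsDPL meet join neg ⊤ ⊥) where

  open IsDPL isDPL using (isSMA; dpl)
  open SMAKernel meet join neg ⊤ ⊥ isSMA
  open Kernel _∧_ _∨_ _′ ⊤ ⊥
  open IsSMA isSMA using (isBDL)
  open IsBoundedDistributiveLattice isBDL using (isDistributiveLattice)
  open LatticeStructures.IsDistributiveLattice isDistributiveLattice using (∧-comm)
  open ≡-Reasoning

  -- The law a' ∧ a'' = ⊥, applied to a = e α, is the kernel complement law.
  ∩-complement : ∀ α → (α ∩ (α *)) ≈K 𝟘
  ∩-complement α = begin
    e (α ∩ (α *))                ≡⟨ e-∩ α (α *) ⟩
    e α ∧ e (α *)                ≡⟨ cong (e α ∧_) (e-* α) ⟩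
    e α ∧ e α ′                  ≡⟨ cong (_∧ e α ′) (e-fixed α) ⟨
    e α ′ ′ ∧ e α ′              ≡⟨ ∧-comm _ _ ⟩
    e α ′ ∧ e α ′ ′              ≡⟨ dpl (e α) ⟩
    ⊥                            ≡⟨ e-𝟘 ⟨
    e 𝟘                          ∎

  kernel-isBoolean : IsBooleanAlg _≈K_ _∩_ _∪_ _* 𝟙 𝟘
  kernel-isBoolean = record
    { isDeMorganAlgebra = kernel-isDeMorgan
    ; ∩-complement      = ∩-complement
    }

corollary3p4 : ∀ {a : Level} {L : Set a} (_∧_ _∨_ : Op₂ L) (_′ : Op₁ L) (⊤ ⊥ : L) →
    IsDPL _∧_ _∨_ _′ ⊤ ⊥ →
    IsBooleanAlg (Kernel._≈K_ _∧_ _∨_ _′ ⊤ ⊥)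
      (Kernel._∩_ _∧_ _∨_ _′ ⊤ ⊥) (Kernel._∪_ _∧_ _∨_ _′ ⊤ ⊥)
      (Kernel._* _∧_ _∨_ _′ ⊤ ⊥) (Kernel.𝟙 _∧_ _∨_ _′ ⊤ ⊥) (Kernel.𝟘 _∧_ _∨_ _′ ⊤ ⊥)
corollary3p4 _∧_ _∨_ _′ ⊤ ⊥ dpl = DPLKernel.kernel-isBoolean _∧_ _∨_ _′ ⊤ ⊥ dpl
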